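{- Let $G$ be a loopless connected graph with a distinguished vertex $v_0$ whose deletion does not disconnect the graph, and let $e_0$ be an edge incident to $v_0$. Suppose that $G$ is $k$-near-cubic ($v_0$ has degree $k$ and every other vertex has degree $3$) of size $n$, i.e. $G$ has $3n+2k-3$ edges. Then there are exactly $2^n$ spanning trees of $G$ containing $e_0$ and such that every edge of $G$ not in the tree joins two comparable vertices.
   Context: Multiple edges are allowed. For a spanning tree $T$ rooted at $v_0$: $u$ is an ancestor of $v$ if $u$ lies on the path in $T$ from $v_0$ to $v$, and $u,v$ are comparable if one is an ancestor of the other. Equivalently, the trees counted are the spanning trees obtainable by a depth-first search of $G$ started at $v_0$ that contain $e_0$. -}

module Defs where

open import Data.Nat using (ℕ; zero; suc; _+_; _*_; _^_)
open import Data.Fin using (Fin; _≟_)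
open import Data.Fin.Subset using (Subset) renaming (_∈_ to _∈ₛ_; _∉_ to _∉ₛ_)
open import Data.Product using (Σ; _×_; _,_; proj₁; proj₂; ∃; ∃-syntax)
open import Data.Sum using (_⊎_)
open import Data.List using (List; []; _∷_; length; filter; allFin)
open import Data.List.Membership.Propositional using (_∈_)
open import Data.List.Relation.Unary.Unique.Propositional using (Unique)
open import Data.List.Relation.Unary.All using (All)
open import Relation.Binary.PropositionalEquality using (_≡_; _≢_)
open import Relation.Nullary using (¬_)
open import Relation.Nullary.Decidable using (_⊎-dec_)
open import Data.Unit using (⊤)

record Multigraph : Set where
  field
    V : ℕ
    E : ℕ
    ends : Fin E → Fin V × Fin V

module _ (G : Multigraph) where
  open Multigraph G

  Loopless : Set
  Loopless = (e : Fin E) → proj₁ (ends e) ≢ proj₂ (ends e)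

  Joins : Fin E → Fin V → Fin V → Set
  Joins e u w = (ends e ≡ (u , w)) ⊎ (ends e ≡ (w , u))

  Incident : Fin E → Fin V → Set
  Incident e v = (proj₁ (ends e) ≡ v) ⊎ (proj₂ (ends e) ≡ v)

  -- degree of v (number of incident edges; each edge counted once since
  -- the graph is assumed loopless where this is used)
  degree : Fin V → ℕ
  degree v = length (filter (λ e → (proj₁ (ends e) ≟ v) ⊎-dec (proj₂ (ends e) ≟ v)) (allFin E))

  data Walk (P : Fin E → Set) : Fin V → Fin V → List (Fin V) → Set where
    nil  : ∀ {v} → Walk P v v (v ∷ [])
    cons : ∀ {u w v vs} (e : Fin E) → P e → Joins e u w →
           Walk P w v vs → Walk P u v (u ∷ vs)

  Reach : (Fin E → Set) → Fin V → Fin V → Set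
  Reach P u v = ∃[ vs ] Walk P u v vs

  Connected : Set
  Connected = (u v : Fin V) → Reach (λ _ → ⊤) u v

  DeletionConnected : Fin V → Set
  DeletionConnected v0 = (u v : Fin V) → u ≢ v0 → v ≢ v0 →
    ∃[ vs ] (Walk (λ _ → ⊤) u v vs × All (λ x → x ≢ v0) vs)

  InS : Subset E → Fin E → Set
  InS T e = e ∈ₛ T

  -- T is a spanning tree: (V, T) is connected and acyclic, where acyclic
  -- means no edge of T lies on a cycle of T, i.e. the endpoints of any
  -- e ∈ T are not connected in T minus e.
  SpanningTree : Subset E → Set
  SpanningTree T =
    ((u v : Fin V) → Reach (InS T) u v) ×
    ((e : Fin E) → e ∈ₛ T →
       ¬ Reach (λ f → f ∈ₛ T × f ≢ e) (proj₁ (ends e)) (proj₂ (ends e)))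

  Ancestor : Subset E → Fin V → Fin V → Fin V → Set
  Ancestor T r u v = ∃[ vs ] (Walk (InS T) r v vs × Unique vs × u ∈ vs)

  Comparable : Subset E → Fin V → Fin V → Fin V → Set
  Comparable T r u v = Ancestor T r u v ⊎ Ancestor T r v u

  GoodTree : Fin V → Fin E → Subset E → Set
  GoodTree r e0 T = SpanningTree T × e0 ∈ₛ T ×
    ((e : Fin E) → e ∉ₛ T → Comparable T r (proj₁ (ends e)) (proj₂ (ends e)))

HasExactly : {A : Set} → (A → Set) → ℕ → Set
HasExactly {A} P N = Σ (List A) λ ts →
  length ts ≡ N × Unique ts × ((t : A) → (t ∈ ts → P t) × (P t → t ∈ ts))

-- Generalise from trees to forests: for a vertex set S and a list R of roots, call F ⊆ E(G[S]) good if it is a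
-- spanning forest of G[S] whose trees are rooted at R and every other edge of G[S] joins comparable vertices.
-- If G[S] has maximum degree 3, every root has degree at most 2 and each component contains exactly one root, then
-- there are exactly 2^(|E(S)| + |R| - |S|) good forests.  This goes by induction on |S|, deleting the first root r:
-- removing the tree edges at r turns a good forest into a good forest of S - r rooted at their far ends, and
-- conversely.  If r has degree at most 1, or its two neighbours are disconnected in S - r, all edges at r are
-- forced into the forest; if the neighbours are connected, exactly one of the two edges is used and either works.
-- The theorem is the case S = V - v0 with the single root at the far end of e0, because connectivity of G - v0
-- forces e0 to be the only tree edge at v0; counting edges turns the exponent into n.

module Submission where

open import Defs
open import Data.Nat using (ℕ; zero; suc; _+_; _*_; _^_; _≤_; _<_; z≤n; s≤s; s≤s⁻¹)
open import Data.Nat.Properties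
  using (≤-trans; ≤-antisym; ≤-reflexive; m≤n⇒m≤1+n; suc-injective; +-suc; +-comm; +-assoc; +-identityʳ;
         +-cancelʳ-≡; *-suc; *-zeroʳ; *-comm; *-assoc; *-distribˡ-+; *-cancelˡ-≡; m^n≢0; ^-distribˡ-+-*;
         +-commutativeSemigroup)
open import Data.Nat.ListAction using (sum)
open import Data.Nat.Tactic.RingSolver using (solve-∀)
open import Algebra.Properties.CommutativeSemigroup +-commutativeSemigroup using (x∙yz≈y∙xz)
open import Data.Fin using (Fin; _≟_)
open import Data.Vec using (_∷_; here; there)
open import Data.Fin.Subset using (Subset; inside; outside; ⁅_⁆; _∪_; _─_; _-_; _⊆_; ∣_∣)
  renaming (_∈_ to _∈ₛ_; _∉_ to _∉ₛ_; ⊥ to ∅; ⊤ to full)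
open import Data.Fin.Subset.Properties
  using (∉⊥; ∈⊤; ∣⊥∣≡0; ∣⊤∣≡n; Empty-unique; x∈⁅x⁆; x∈⁅y⁆⇒x≡y; x∈p∪q⁺; x∈p∪q⁻; ⊆-antisym;
         p─q⊆p; p─⊥≡p; x∈p∧x∉q⇒x∈p─q; x∈p∧x≢y⇒x∈p-y)
  renaming (_∈?_ to _∈ₛ?_)
open import Data.Product using (_×_; _,_; proj₁; proj₂; ∃-syntax)
import Data.Product
open import Data.Sum using (_⊎_; inj₁; inj₂; [_,_]′)
import Data.Sum
open import Data.List using (List; []; _∷_; _++_; map; length; filter; allFin; foldr)
open import Data.List.Properties using (filter-none; filter-all; length-map; length-++; length-tabulate)
open import Data.List.Membership.Propositional using (_∈_; _∉_; find; lose)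
open import Data.List.Membership.Propositional.Properties
  using (∈-map⁺; ∈-map⁻; ∈-++⁺ˡ; ∈-++⁺ʳ; ∈-++⁻; ∈-filter⁺; ∈-filter⁻; ∈-allFin)
open import Data.List.Relation.Unary.Any using (here; there; any?)
open import Data.List.Relation.Unary.All using (All; []; _∷_)
import Data.List.Relation.Unary.All as All
import Data.List.Relation.Unary.All.Properties as All
open import Data.List.Relation.Unary.All.Properties.Core using (¬Any⇒All¬; All¬⇒¬Any)
open import Data.List.Relation.Unary.AllPairs using (AllPairs; []; _∷_)
import Data.List.Relation.Unary.AllPairs as AllPairs
import Data.List.Relation.Unary.AllPairs.Properties as AllPairs
open import Data.List.Relation.Unary.Unique.Propositional using (Unique)
import Data.List.Relation.Unary.Unique.Propositional.Properties as Unique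
open import Relation.Binary.PropositionalEquality
open import Relation.Nullary using (¬_; Dec; yes; no; contradiction)
open import Relation.Nullary.Decidable using (_×-dec_; _⊎-dec_; map′)
open import Relation.Unary using (Pred; Decidable)
open import Function using (_∘_; id)
open import Level using (0ℓ)

-- Counting and exact enumerations

module _ {A : Set} where

  count : {P : Pred A 0ℓ} → Decidable P → List A → ℕ
  count P? xs = length (filter P? xs)

  module _ {P Q : Pred A 0ℓ} (P? : Decidable P) (Q? : Decidable Q) (P⇒Q : ∀ {x} → P x → Q x) where

    count-mono : ∀ xs → count P? xs ≤ count Q? xs
    count-mono [] = z≤n
    count-mono (x ∷ xs) with P? x | Q? x
    ... | yes _ | yes _ = s≤s (count-mono xs)
    ... | yes p | no ¬q = contradiction (P⇒Q p) ¬q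
    ... | no _  | yes _ = m≤n⇒m≤1+n (count-mono xs)
    ... | no _  | no _  = count-mono xs

    count-mono-< : ∀ {y} xs → y ∈ xs → ¬ P y → Q y → count P? xs < count Q? xs
    count-mono-< (x ∷ xs) (here refl) ¬py qy with P? x | Q? x
    ... | yes py | _     = contradiction py ¬py
    ... | no _   | no ¬q = contradiction qy ¬q
    ... | no _   | yes _ = s≤s (count-mono xs)
    count-mono-< (x ∷ xs) (there y∈xs) ¬py qy with P? x | Q? x
    ... | yes _ | yes _ = s≤s (count-mono-< xs y∈xs ¬py qy)
    ... | yes p | no ¬q = contradiction (P⇒Q p) ¬q
    ... | no _  | yes _ = m≤n⇒m≤1+n (count-mono-< xs y∈xs ¬py qy)
    ... | no _  | no _  = count-mono-< xs y∈xs ¬py qy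

  count-⊎ : {P Q R : Pred A 0ℓ} (P? : Decidable P) (Q? : Decidable Q) (R? : Decidable R) →
            (∀ {x} → P x → ¬ Q x) → (∀ {x} → R x → P x ⊎ Q x) → (∀ {x} → P x ⊎ Q x → R x) →
            ∀ xs → count P? xs + count Q? xs ≡ count R? xs
  count-⊎ P? Q? R? disj split join [] = refl
  count-⊎ P? Q? R? disj split join (x ∷ xs) with P? x | Q? x | R? x
  ... | yes p | yes q | _     = contradiction q (disj p)
  ... | yes _ | no _  | yes _ = cong suc (count-⊎ P? Q? R? disj split join xs)
  ... | yes p | no _  | no ¬r = contradiction (join (inj₁ p)) ¬r
  ... | no _  | yes _ | yes _ = trans (+-suc _ _) (cong suc (count-⊎ P? Q? R? disj split join xs))
  ... | no _  | yes q | no ¬r = contradiction (join (inj₂ q)) ¬r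
  ... | no ¬p | no ¬q | yes r = contradiction (split r) [ ¬p , ¬q ]′
  ... | no _  | no _  | no _  = count-⊎ P? Q? R? disj split join xs

  count-none : {P : Pred A 0ℓ} (P? : Decidable P) → ∀ {xs} → All (λ x → ¬ P x) xs → count P? xs ≡ 0
  count-none P? none = cong length (filter-none P? none)

count-≟ : ∀ {n} {a : Fin n} {xs} → Unique xs → a ∈ xs → count (a ≟_) xs ≡ 1
count-≟ {a = a} (a∉xs ∷ _) (here refl) with a ≟ a
... | yes _ = cong suc (count-none (a ≟_) a∉xs)
... | no a≢a = contradiction refl a≢a
count-≟ {a = a} {x ∷ _} (x∉xs ∷ unique) (there a∈xs) with a ≟ x
... | yes refl = contradiction refl (All.lookup x∉xs a∈xs)
... | no _ = count-≟ unique a∈xs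

module _ {A B : Set} {R : A → B → Set} (R? : ∀ x y → Dec (R x y)) where

  private
    column : List A → B → ℕ
    column xs y = count (λ x → R? x y) xs

    row : List B → A → ℕ
    row ys x = count (R? x) ys

    sum-column-∷ : ∀ x xs ys → sum (map (column (x ∷ xs)) ys) ≡ row ys x + sum (map (column xs) ys)
    sum-column-∷ x xs [] = refl
    sum-column-∷ x xs (y ∷ ys) with R? x y
    ... | yes _ = cong suc (trans (cong (column xs y +_) (sum-column-∷ x xs ys))
                                  (x∙yz≈y∙xz (column xs y) (row ys x) _))
    ... | no _ = trans (cong (column xs y +_) (sum-column-∷ x xs ys))
                       (x∙yz≈y∙xz (column xs y) (row ys x) _)

    sum-column-[] : ∀ ys → sum (map (column []) ys) ≡ 0
    sum-column-[] [] = refl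
    sum-column-[] (_ ∷ ys) = sum-column-[] ys

  count-swap : ∀ xs ys → sum (map (λ x → count (R? x) ys) xs) ≡ sum (map (λ y → count (λ x → R? x y) xs) ys)
  count-swap [] ys = sym (sum-column-[] ys)
  count-swap (x ∷ xs) ys = trans (cong (row ys x +_) (count-swap xs ys)) (sym (sum-column-∷ x xs ys))

module _ {A : Set} (f : A → ℕ) (c : ℕ) where

  sum-map-const : ∀ {xs} → All (λ x → f x ≡ c) xs → sum (map f xs) ≡ c * length xs
  sum-map-const {[]} [] = sym (*-zeroʳ c)
  sum-map-const {x ∷ xs} (fx≡c ∷ f≡c) = trans (cong₂ _+_ fx≡c (sum-map-const f≡c)) (sym (*-suc c (length xs)))

  sum-map-except : ∀ {a xs} → Unique xs → a ∈ xs → (∀ x → x ≢ a → f x ≡ c) →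
                   sum (map f xs) + c ≡ f a + c * length xs
  sum-map-except {a} {_ ∷ xs} (a∉xs ∷ _) (here refl) f≡c = begin
    f a + sum (map f xs) + c   ≡⟨ +-assoc (f a) _ c ⟩
    f a + (sum (map f xs) + c) ≡⟨ cong (λ s → f a + (s + c))
                                       (sum-map-const (All.map (λ a≢x → f≡c _ (a≢x ∘ sym)) a∉xs)) ⟩
    f a + (c * length xs + c)  ≡⟨ cong (f a +_) (trans (+-comm _ c) (sym (*-suc c (length xs)))) ⟩
    f a + c * suc (length xs)  ∎
    where open ≡-Reasoning
  sum-map-except {a} {x ∷ xs} (x∉xs ∷ unique) (there a∈xs) f≡c = begin
    f x + sum (map f xs) + c   ≡⟨ +-assoc (f x) _ c ⟩
    f x + (sum (map f xs) + c) ≡⟨ cong₂ _+_ (f≡c x (All.lookup x∉xs a∈xs)) (sum-map-except unique a∈xs f≡c) ⟩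
    c + (f a + c * length xs)  ≡⟨ x∙yz≈y∙xz c (f a) _ ⟩
    f a + (c + c * length xs)  ≡⟨ cong (f a +_) (*-suc c (length xs)) ⟨
    f a + c * suc (length xs)  ∎
    where open ≡-Reasoning

module _ {A B : Set} {P : A → Set} {Q : B → Set} (g : A → B)
         (sound : ∀ {x} → P x → Q (g x))
         (complete : ∀ {y} → Q y → ∃[ x ] (P x × g x ≡ y))
         (injective : ∀ {x y} → P x → P y → g x ≡ g y → x ≡ y) where

  private
    unique-map : ∀ {xs} → (∀ {x} → x ∈ xs → P x) → Unique xs → Unique (map g xs)
    unique-map {[]} _ [] = []
    unique-map {x ∷ xs} P∈ (x∉xs ∷ unique) =
      All.map⁺ (All.tabulate λ y∈xs gx≡gy → All.lookup x∉xs y∈xs (injective (P∈ (here refl)) (P∈ (there y∈xs)) gx≡gy))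
      ∷ unique-map (P∈ ∘ there) unique

  hasExactly-map : ∀ {n} → HasExactly P n → HasExactly Q n
  hasExactly-map (xs , |xs|≡n , unique , spec) =
    map g xs , trans (length-map g xs) |xs|≡n , unique-map (λ {x} x∈xs → proj₁ (spec x) x∈xs) unique ,
    λ y → image⇒Q , Q⇒image
    where
    image⇒Q : ∀ {y} → y ∈ map g xs → Q y
    image⇒Q y∈ with ∈-map⁻ g y∈
    ... | x , x∈xs , refl = sound (proj₁ (spec x) x∈xs)
    Q⇒image : ∀ {y} → Q y → y ∈ map g xs
    Q⇒image qy with complete qy
    ... | x , px , refl = ∈-map⁺ g (proj₂ (spec x) px)

module _ {A : Set} {P Q : A → Set} where

  hasExactly-⇔ : (∀ {x} → P x → Q x) → (∀ {x} → Q x → P x) → ∀ {n} → HasExactly P n → HasExactly Q n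
  hasExactly-⇔ P⇒Q Q⇒P = hasExactly-map id P⇒Q (λ qx → _ , Q⇒P qx , refl) (λ _ _ eq → eq)

  hasExactly-⊎ : (∀ {x} → P x → ¬ Q x) → ∀ {m n} → HasExactly P m → HasExactly Q n →
                 HasExactly (λ x → P x ⊎ Q x) (m + n)
  hasExactly-⊎ disjoint (xs , |xs|≡m , uxs , specP) (ys , |ys|≡n , uys , specQ) =
    xs ++ ys , trans (length-++ xs) (cong₂ _+_ |xs|≡m |ys|≡n) ,
    Unique.++⁺ uxs uys (λ (x∈xs , x∈ys) → disjoint (proj₁ (specP _) x∈xs) (proj₁ (specQ _) x∈ys)) ,
    λ x → [ (inj₁ ∘ proj₁ (specP x)) , (inj₂ ∘ proj₁ (specQ x)) ]′ ∘ ∈-++⁻ xs ,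
          [ ∈-++⁺ˡ ∘ proj₂ (specP x) , ∈-++⁺ʳ xs ∘ proj₂ (specQ x) ]′

hasExactly-singleton : {A : Set} {P : A → Set} {a : A} → P a → (∀ {x} → P x → x ≡ a) → HasExactly P 1
hasExactly-singleton pa unique = _ ∷ [] , refl , [] ∷ [] , λ x → (λ { (here refl) → pa }) , λ px → here (unique px)

-- Subsets

private
  variable
    n : ℕ

x∈p─q⇒x∉q : ∀ (p q : Subset n) {x} → x ∈ₛ p ─ q → x ∉ₛ q
x∈p─q⇒x∉q (_ ∷ p) (outside ∷ q) here ()
x∈p─q⇒x∉q (_ ∷ p) (_ ∷ q) (there x∈p─q) (there x∈q) = x∈p─q⇒x∉q p q x∈p─q x∈q

x∈p-y⇒x≢y : ∀ {p : Subset n} {x y} → x ∈ₛ p - y → x ≢ y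
x∈p-y⇒x≢y {p = p} {x} {y} x∈p-y refl = x∈p─q⇒x∉q p ⁅ y ⁆ x∈p-y (x∈⁅x⁆ x)

∣p∣≡1+∣p-x∣ : ∀ {p : Subset n} {x} → x ∈ₛ p → ∣ p ∣ ≡ suc ∣ p - x ∣
∣p∣≡1+∣p-x∣ {p = inside ∷ p} here = cong (suc ∘ ∣_∣) (sym (p─⊥≡p p))
∣p∣≡1+∣p-x∣ {p = inside ∷ p} (there x∈p) = cong suc (∣p∣≡1+∣p-x∣ x∈p)
∣p∣≡1+∣p-x∣ {p = outside ∷ p} (there x∈p) = ∣p∣≡1+∣p-x∣ x∈p

[p─q]∪q≡p : ∀ {p q : Subset n} → q ⊆ p → (p ─ q) ∪ q ≡ p
[p─q]∪q≡p {p = p} {q} q⊆p = ⊆-antisym (λ x∈ → [ p─q⊆p p q , q⊆p ]′ (x∈p∪q⁻ (p ─ q) q x∈)) ⊇-part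
  where
  ⊇-part : p ⊆ (p ─ q) ∪ q
  ⊇-part {x} x∈p with x ∈ₛ? q
  ... | yes x∈q = x∈p∪q⁺ (inj₂ x∈q)
  ... | no x∉q = x∈p∪q⁺ (inj₁ (x∈p∧x∉q⇒x∈p─q x∈p x∉q))

[p∪q]─q≡p : ∀ {p q : Subset n} → (∀ {x} → x ∈ₛ p → x ∉ₛ q) → (p ∪ q) ─ q ≡ p
[p∪q]─q≡p {p = p} {q} disjoint = ⊆-antisym ⊆-part (λ x∈p → x∈p∧x∉q⇒x∈p─q (x∈p∪q⁺ (inj₁ x∈p)) (disjoint x∈p))
  where
  ⊆-part : (p ∪ q) ─ q ⊆ p
  ⊆-part x∈ with x∈p∪q⁻ p q (p─q⊆p (p ∪ q) q x∈)
  ... | inj₁ x∈p = x∈p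
  ... | inj₂ x∈q = contradiction x∈q (x∈p─q⇒x∉q (p ∪ q) q x∈)

fromList : List (Fin n) → Subset n
fromList = foldr (λ x p → ⁅ x ⁆ ∪ p) ∅

∈-fromList⁺ : ∀ {x : Fin n} {xs} → x ∈ xs → x ∈ₛ fromList xs
∈-fromList⁺ (here refl) = x∈p∪q⁺ (inj₁ (x∈⁅x⁆ _))
∈-fromList⁺ (there x∈xs) = x∈p∪q⁺ (inj₂ (∈-fromList⁺ x∈xs))

∈-fromList⁻ : ∀ {x : Fin n} {xs} → x ∈ₛ fromList xs → x ∈ xs
∈-fromList⁻ {xs = []} x∈ = contradiction x∈ ∉⊥
∈-fromList⁻ {xs = y ∷ xs} x∈ with x∈p∪q⁻ ⁅ y ⁆ (fromList xs) x∈
... | inj₁ x∈⁅y⁆ = here (x∈⁅y⁆⇒x≡y y x∈⁅y⁆)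
... | inj₂ x∈xs = there (∈-fromList⁻ x∈xs)

allPairs-∈ : {A : Set} {R : A → A → Set} {x y : A} {xs : List A} → (∀ {x y} → R x y → R y x) →
             AllPairs R xs → x ∈ xs → y ∈ xs → x ≢ y → R x y
allPairs-∈ sym (_ ∷ _) (here refl) (here refl) x≢y = contradiction refl x≢y
allPairs-∈ sym (Rx ∷ _) (here refl) (there y∈xs) _ = All.lookup Rx y∈xs
allPairs-∈ sym (Ry ∷ _) (there x∈xs) (here refl) _ = sym (All.lookup Ry x∈xs)
allPairs-∈ sym (_ ∷ pairs) (there x∈xs) (there y∈xs) x≢y = allPairs-∈ sym pairs x∈xs y∈xs x≢y

length-allFin : ∀ n → length (allFin n) ≡ n
length-allFin n = length-tabulate id

-- Walks and reachability

module _ (G : Multigraph) where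
  open Multigraph G
  open import Data.List.Membership.DecPropositional (_≟_ {n = V}) using (_∈?_)

  private
    variable
      P Q : Fin E → Set
      a b u v w r : Fin V
      vs : List (Fin V)
      e f g : Fin E
      F T : Subset E
      ρ : Fin V

  joins-sym : Joins G e u v → Joins G e v u
  joins-sym (inj₁ eq) = inj₂ eq
  joins-sym (inj₂ eq) = inj₁ eq

  joins⇒incident : Joins G e u v → Incident G e u
  joins⇒incident (inj₁ refl) = inj₁ refl
  joins⇒incident (inj₂ refl) = inj₂ refl

  joins-incident : Joins G e a b → Incident G e r → a ≡ r ⊎ b ≡ r
  joins-incident (inj₁ refl) (inj₁ refl) = inj₁ refl
  joins-incident (inj₁ refl) (inj₂ refl) = inj₂ refl
  joins-incident (inj₂ refl) (inj₁ refl) = inj₂ refl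
  joins-incident (inj₂ refl) (inj₂ refl) = inj₁ refl

  walk-map : (∀ {e} → P e → Q e) → Walk G P u v vs → Walk G Q u v vs
  walk-map P⇒Q nil = nil
  walk-map P⇒Q (cons e pe j w) = cons e (P⇒Q pe) j (walk-map P⇒Q w)

  reach-map : (∀ {e} → P e → Q e) → Reach G P u v → Reach G Q u v
  reach-map P⇒Q (_ , w) = _ , walk-map P⇒Q w

  reach-refl : Reach G P u u
  reach-refl = _ , nil

  reach-edge : P e → Joins G e u v → Reach G P u v
  reach-edge pe j = _ , cons _ pe j nil

  reach-trans : Reach G P u v → Reach G P v w → Reach G P u w
  reach-trans (_ , nil) r₂ = r₂
  reach-trans (_ , cons e pe j w) r₂ = _ , cons e pe j (proj₂ (reach-trans (_ , w) r₂))

  reach-sym : Reach G P u v → Reach G P v u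
  reach-sym (_ , nil) = reach-refl
  reach-sym (_ , cons e pe j w) = reach-trans (reach-sym (_ , w)) (reach-edge pe (joins-sym j))

  walk-head∈ : Walk G P u v vs → u ∈ vs
  walk-head∈ nil = here refl
  walk-head∈ (cons _ _ _ _) = here refl

  walk-prefix : Walk G P u v vs → w ∈ vs → Reach G P u w
  walk-prefix nil (here refl) = reach-refl
  walk-prefix (cons e pe j w) (here refl) = reach-refl
  walk-prefix (cons e pe j w) (there w∈vs) = reach-trans (reach-edge pe j) (walk-prefix w w∈vs)

  private
    walk-suffix : Walk G P u v vs → w ∈ vs → ∃[ ws ] (Walk G P w v ws × (Unique vs → Unique ws))
    walk-suffix nil (here refl) = _ , nil , id
    walk-suffix w@(cons _ _ _ _) (here refl) = _ , w , id
    walk-suffix (cons e pe j w) (there w∈vs) with walk-suffix w w∈vs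
    ... | ws , w′ , unique = ws , w′ , λ { (_ ∷ u) → unique u }

  walk⇒path : Walk G P u v vs → ∃[ ws ] (Walk G P u v ws × Unique ws)
  walk⇒path nil = _ , nil , [] ∷ []
  walk⇒path {u = u} (cons e pe j w) with walk⇒path w
  ... | ws , path , unique with u ∈? ws
  ...   | yes u∈ws = let (zs , path′ , unique′) = walk-suffix path u∈ws in zs , path′ , unique′ unique
  ...   | no u∉ws = u ∷ ws , cons e pe j path , ¬Any⇒All¬ ws u∉ws ∷ unique

  walk-restrict : (∀ {e a b} → P e → Joins G e a b → a ≢ r → b ≢ r → Q e) →
                  Walk G P u v vs → r ∉ vs → Walk G Q u v vs
  walk-restrict P⇒Q nil r∉vs = nil
  walk-restrict P⇒Q (cons e pe j w) r∉vs =
    cons e (P⇒Q pe j (λ { refl → r∉vs (here refl) }) (λ { refl → r∉vs (there (walk-head∈ w)) })) j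
         (walk-restrict P⇒Q w (r∉vs ∘ there))

  walk-avoids : (∀ {e} → P e → ¬ Incident G e r) → u ≢ r → Walk G P u v vs → r ∉ vs
  walk-avoids off u≢r nil (here refl) = u≢r refl
  walk-avoids off u≢r (cons e pe j w) (here refl) = u≢r refl
  walk-avoids off u≢r (cons e pe j w) (there r∈vs) =
    walk-avoids off (λ { refl → off pe (joins⇒incident (joins-sym j)) }) w r∈vs

  walk-lastVisit : Walk G P u v vs → r ∈ vs → v ≢ r →
                   ∃[ f ] ∃[ y ] (P f × Joins G f r y × ∃[ ws ] (Walk G P y v ws × r ∉ ws))
  walk-lastVisit nil (here refl) v≢r = contradiction refl v≢r
  walk-lastVisit {r = r} (cons {vs = ws} e pe j w) r∈vs v≢r with r ∈? ws
  ... | yes r∈ws = walk-lastVisit w r∈ws v≢r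
  ... | no r∉ws with r∈vs
  ...   | here refl = e , _ , pe , j , ws , w , r∉ws
  ...   | there r∈ws = contradiction r∈ws r∉ws

  walk-firstVisit : Walk G P u v vs → r ∈ vs → u ≢ r →
                    ∃[ f ] ∃[ y ] (P f × Joins G f r y × ∃[ ws ] (Walk G P u y ws × r ∉ ws))
  walk-firstVisit nil (here refl) u≢r = contradiction refl u≢r
  walk-firstVisit {r = r} (cons {w = x} e pe j w) r∈vs u≢r with x ≟ r
  ... | yes refl = e , _ , pe , joins-sym j , _ , nil , λ { (here refl) → u≢r refl }
  ... | no x≢r with r∈vs
  ...   | here refl = contradiction refl u≢r
  ...   | there r∈ws with walk-firstVisit w r∈ws x≢r
  ...     | f , y , pf , jf , ws , w′ , r∉ws =
              f , y , pf , jf , _ , cons e pe j w′ , λ { (here refl) → u≢r refl ; (there r∈) → r∉ws r∈ }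

  joins-ends : ∀ {X : Fin V → Set} → Joins G e a b → X (proj₁ (ends e)) → X (proj₂ (ends e)) → X a × X b
  joins-ends (inj₁ refl) x₁ x₂ = x₁ , x₂
  joins-ends (inj₂ refl) x₁ x₂ = x₂ , x₁

  reach-across : Joins G e a b → Reach G P (proj₁ (ends e)) (proj₂ (ends e)) → Reach G P a b
  reach-across (inj₁ refl) reach = reach
  reach-across (inj₂ refl) reach = reach-sym reach

  reach-along : Joins G e a b → Reach G P a b → Reach G P (proj₁ (ends e)) (proj₂ (ends e))
  reach-along (inj₁ refl) reach = reach
  reach-along (inj₂ refl) reach = reach-sym reach

  ancestor-map : (∀ {e} → e ∈ₛ F → e ∈ₛ T) → Ancestor G F ρ a b → Ancestor G T ρ a b
  ancestor-map F⊆T (vs , walk , unique , a∈vs) = vs , walk-map F⊆T walk , unique , a∈vs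

  comparable-map : (∀ {e} → e ∈ₛ F → e ∈ₛ T) → Comparable G F ρ a b → Comparable G T ρ a b
  comparable-map F⊆T = Data.Sum.map (ancestor-map F⊆T) (ancestor-map F⊆T)

  ancestor-joins : Joins G e a b → Ancestor G T ρ a b → Comparable G T ρ (proj₁ (ends e)) (proj₂ (ends e))
  ancestor-joins (inj₁ refl) = inj₁
  ancestor-joins (inj₂ refl) = inj₂

  ancestor⇒reach : Ancestor G T ρ a b → Reach G (InS G T) ρ a × Reach G (InS G T) ρ b
  ancestor⇒reach (vs , walk , _ , a∈vs) = walk-prefix walk a∈vs , (vs , walk)

  comparable⇒reach : Comparable G T ρ a b → Reach G (InS G T) ρ a × Reach G (InS G T) ρ b
  comparable⇒reach (inj₁ anc) = ancestor⇒reach anc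
  comparable⇒reach (inj₂ anc) = Data.Product.swap (ancestor⇒reach anc)

  -- Induced subgraphs and degrees

  other : Fin V → Fin E → Fin V
  other r e with proj₁ (ends e) ≟ r
  ... | yes _ = proj₂ (ends e)
  ... | no _ = proj₁ (ends e)

  joins-other : Incident G e r → Joins G e r (other r e)
  joins-other {e} {r} inc with proj₁ (ends e) ≟ r | inc
  ... | yes refl | _ = inj₁ refl
  ... | no ≢r | inj₁ ≡r = contradiction ≡r ≢r
  ... | no _ | inj₂ refl = inj₂ refl

  joins⇒≡other : Joins G e r v → v ≡ other r e
  joins⇒≡other {e} {r} j with proj₁ (ends e) ≟ r | j
  ... | yes _ | inj₁ refl = refl
  ... | yes ≡r | inj₂ eq = trans (sym (cong proj₁ eq)) (trans ≡r (sym (cong proj₂ eq)))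
  ... | no ≢r | inj₁ refl = contradiction refl ≢r
  ... | no _ | inj₂ refl = refl

  incident? : ∀ v e → Dec (Incident G e v)
  incident? v e = (proj₁ (ends e) ≟ v) ⊎-dec (proj₂ (ends e) ≟ v)

  EdgeOf : Subset V → Fin E → Set
  EdgeOf S e = proj₁ (ends e) ∈ₛ S × proj₂ (ends e) ∈ₛ S

  edgeOf? : ∀ S → Decidable (EdgeOf S)
  edgeOf? S e = (proj₁ (ends e) ∈ₛ? S) ×-dec (proj₂ (ends e) ∈ₛ? S)

  ReachIn : Subset V → Fin V → Fin V → Set
  ReachIn S = Reach G (EdgeOf S)

  private
    variable
      S : Subset V

  edgeOf-joins : EdgeOf S e → Joins G e a b → a ∈ₛ S × b ∈ₛ S
  edgeOf-joins (a∈S , b∈S) (inj₁ refl) = a∈S , b∈S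
  edgeOf-joins (b∈S , a∈S) (inj₂ refl) = a∈S , b∈S

  edgeOf-incident : EdgeOf S e → Incident G e v → v ∈ₛ S
  edgeOf-incident (x∈S , _) (inj₁ refl) = x∈S
  edgeOf-incident (_ , y∈S) (inj₂ refl) = y∈S

  edgeOf-─⁻ : EdgeOf (S - r) e → EdgeOf S e × ¬ Incident G e r
  edgeOf-─⁻ {S = S} {r} (x∈ , y∈) =
    (p─q⊆p S ⁅ r ⁆ x∈ , p─q⊆p S ⁅ r ⁆ y∈) , [ x∈p-y⇒x≢y x∈ , x∈p-y⇒x≢y y∈ ]′

  edgeOf-─⁺ : EdgeOf S e → ¬ Incident G e r → EdgeOf (S - r) e
  edgeOf-─⁺ (x∈ , y∈) ¬inc = x∈p∧x≢y⇒x∈p-y x∈ (¬inc ∘ inj₁) , x∈p∧x≢y⇒x∈p-y y∈ (¬inc ∘ inj₂)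

  reachIn-─ : ReachIn (S - r) u v → ReachIn S u v
  reachIn-─ = reach-map (proj₁ ∘ edgeOf-─⁻)

  walkIn-─ : Walk G (EdgeOf S) u v vs → r ∉ vs → Walk G (EdgeOf (S - r)) u v vs
  walkIn-─ = walk-restrict λ e∈S j a≢r b≢r → edgeOf-─⁺ e∈S ([ a≢r , b≢r ]′ ∘ joins-incident j)

  edgeCount : Subset V → ℕ
  edgeCount S = count (edgeOf? S) (allFin E)

  edgeAt? : ∀ S v → Decidable (λ e → EdgeOf S e × Incident G e v)
  edgeAt? S v e = edgeOf? S e ×-dec incident? v e

  edgesAt : Subset V → Fin V → List (Fin E)
  edgesAt S v = filter (edgeAt? S v) (allFin E)

  degreeIn : Subset V → Fin V → ℕ
  degreeIn S v = length (edgesAt S v)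

  ∈-edgesAt⁺ : EdgeOf S e → Incident G e v → e ∈ edgesAt S v
  ∈-edgesAt⁺ {e = e} e∈S inc = ∈-filter⁺ (edgeAt? _ _) (∈-allFin e) (e∈S , inc)

  ∈-edgesAt⁻ : e ∈ edgesAt S v → EdgeOf S e × Incident G e v
  ∈-edgesAt⁻ e∈ = proj₂ (∈-filter⁻ (edgeAt? _ _) {xs = allFin E} e∈)

  edgesAt-unique : Unique (edgesAt S v)
  edgesAt-unique = Unique.filter⁺ (edgeAt? _ _) (Unique.allFin⁺ E)

  edgeCount-─ : ∀ S r → edgeCount (S - r) + degreeIn S r ≡ edgeCount S
  edgeCount-─ S r = count-⊎ (edgeOf? (S - r)) (edgeAt? S r) (edgeOf? S)
    (λ e∈S-r (_ , inc) → proj₂ (edgeOf-─⁻ e∈S-r) inc) split [ proj₁ ∘ edgeOf-─⁻ , proj₁ ]′ (allFin E)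
    where
    split : EdgeOf S e → EdgeOf (S - r) e ⊎ (EdgeOf S e × Incident G e r)
    split {e} e∈S with incident? r e
    ... | yes inc = inj₂ (e∈S , inc)
    ... | no ¬inc = inj₁ (edgeOf-─⁺ e∈S ¬inc)

  degreeIn-─ : ∀ S r v → degreeIn (S - r) v ≤ degreeIn S v
  degreeIn-─ S r v = count-mono _ _ (λ (e∈ , inc) → proj₁ (edgeOf-─⁻ e∈) , inc) (allFin E)

  degreeIn-─-< : EdgeOf S e → Incident G e r → degreeIn (S - r) (other r e) < degreeIn S (other r e)
  degreeIn-─-< {e = e} e∈S inc = count-mono-< _ _ (λ (e∈ , inc) → proj₁ (edgeOf-─⁻ e∈) , inc) (allFin E)
    (∈-allFin e) (λ (e∈ , _) → proj₂ (edgeOf-─⁻ e∈) inc) (e∈S , joins⇒incident (joins-sym (joins-other inc)))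

  degreeIn-full : ∀ v → degreeIn full v ≡ degree G v
  degreeIn-full v = ≤-antisym (count-mono _ _ proj₂ (allFin E)) (count-mono _ _ (λ inc → (∈⊤ , ∈⊤) , inc) (allFin E))

  edgeCount-full : edgeCount full ≡ E
  edgeCount-full = trans (cong length (filter-all (edgeOf? full) {xs = allFin E} (All.tabulate λ _ → ∈⊤ , ∈⊤)))
                         (length-allFin E)

  reachIn-firstEdge : ReachIn S u v → u ≢ v → ∃[ e ] (e ∈ edgesAt S u × ReachIn (S - u) (other u e) v)
  reachIn-firstEdge (_ , walk) u≢v with walk-lastVisit walk (walk-head∈ walk) (u≢v ∘ sym)
  ... | f , y , f∈S , j , ws , walk′ , u∉ws =
    f , ∈-edgesAt⁺ f∈S (joins⇒incident j) ,
    subst (λ y → ReachIn (_ - _) y _) (joins⇒≡other j) (ws , walkIn-─ walk′ u∉ws)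

  reachIn? : ∀ S u v → Dec (ReachIn S u v)
  reachIn? S = decide S refl
    where
    decide : ∀ {m} S → ∣ S ∣ ≡ m → ∀ u v → Dec (ReachIn S u v)
    decide S _ u v with u ≟ v | u ∈ₛ? S
    decide S _ u v | yes refl | _ = yes reach-refl
    decide S _ u v | no u≢v | no u∉S =
      no λ reach → let (e , e∈ , _) = reachIn-firstEdge reach u≢v
                       (e∈S , inc) = ∈-edgesAt⁻ e∈
                   in u∉S (edgeOf-incident e∈S inc)
    decide {zero} S |S|≡0 u v | no _ | yes u∈S = contradiction (trans (sym (∣p∣≡1+∣p-x∣ u∈S)) |S|≡0) λ ()
    decide {suc m} S |S|≡1+m u v | no u≢v | yes u∈S =
      map′ (λ any → let (e , e∈ , reach) = find any
                        (e∈S , inc) = ∈-edgesAt⁻ e∈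
                    in reach-trans (reach-edge e∈S (joins-other inc)) (reachIn-─ reach))
           (λ reach → let (e , e∈ , reach′) = reachIn-firstEdge reach u≢v in lose e∈ reach′)
           (any? (λ e → decide (S - u) |S-u|≡m (other u e) v) (edgesAt S u))
      where
      |S-u|≡m : ∣ S - u ∣ ≡ m
      |S-u|≡m = suc-injective (trans (sym (∣p∣≡1+∣p-x∣ u∈S)) |S|≡1+m)

  -- Good forests

  record GoodForest (S : Subset V) (R : List (Fin V)) (F : Subset E) : Set where
    field
      within  : e ∈ₛ F → EdgeOf S e
      rooted  : v ∈ₛ S → ∃[ ρ ] (ρ ∈ R × Reach G (InS G F) ρ v)
      acyclic : e ∈ₛ F → ¬ Reach G (λ f → f ∈ₛ F × f ≢ e) (proj₁ (ends e)) (proj₂ (ends e))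
      normal  : EdgeOf S e → e ∉ₛ F → ∃[ ρ ] (ρ ∈ R × Comparable G F ρ (proj₁ (ends e)) (proj₂ (ends e)))

  module _ (loopless : Loopless G) where

    other-≢ : Incident G e r → other r e ≢ r
    other-≢ {e} inc other≡r with subst (Joins G e _) other≡r (joins-other inc)
    ... | inj₁ eq = loopless e (trans (cong proj₁ eq) (sym (cong proj₂ eq)))
    ... | inj₂ eq = loopless e (trans (cong proj₁ eq) (sym (cong proj₂ eq)))

    module FirstRoot {S : Subset V} {r : Fin V} {R′ : List (Fin V)} (r↛R′ : All (λ ρ → ¬ ReachIn S r ρ) R′) where

      AwayFrom : Subset E → Fin E → Set
      AwayFrom T e = e ∈ₛ T × ¬ Incident G e r

      module TreeAt {T : Subset E} (good : GoodForest S (r ∷ R′) T) where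
        open GoodForest good

        awayWalk : Walk G (InS G T) u v vs → r ∉ vs → Walk G (AwayFrom T) u v vs
        awayWalk = walk-restrict λ e∈T j a≢r b≢r → e∈T , [ a≢r , b≢r ]′ ∘ joins-incident j

        away⇒S-r : AwayFrom T e → EdgeOf (S - r) e
        away⇒S-r (e∈T , ¬inc) = edgeOf-─⁺ (within e∈T) ¬inc

        walkFromR′-avoids : ρ ∈ R′ → Walk G (InS G T) ρ v vs → r ∉ vs
        walkFromR′-avoids ρ∈R′ walk r∈vs =
          All.lookup r↛R′ ρ∈R′ (reach-sym (reach-map within (walk-prefix walk r∈vs)))

        walkFromR′-away : ρ ∈ R′ → Walk G (InS G T) ρ v vs → Walk G (AwayFrom T) ρ v vs
        walkFromR′-away ρ∈R′ walk = awayWalk walk (walkFromR′-avoids ρ∈R′ walk)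

        leave-r : Walk G (InS G T) r v vs → v ≢ r →
                  ∃[ f ] (f ∈ₛ T × Incident G f r × Reach G (AwayFrom T) (other r f) v)
        leave-r walk v≢r with walk-lastVisit walk (walk-head∈ walk) v≢r
        ... | f , y , f∈T , j , ws , walk′ , r∉ws =
          f , f∈T , joins⇒incident j , subst (λ y → Reach G _ y _) (joins⇒≡other j) (ws , awayWalk walk′ r∉ws)

        ancestor-below-r : Ancestor G T r a b → a ≢ r → b ≢ r →
                           ∃[ f ] (f ∈ₛ T × Incident G f r ×
                                   ∃[ ws ] (Walk G (AwayFrom T) (other r f) b ws × Unique ws × a ∈ ws))
        ancestor-below-r (_ , nil , _ , _) _ b≢r = contradiction refl b≢r
        ancestor-below-r (_ , cons {vs = ws} f f∈T j walk , r∉ws ∷ unique , a∈) a≢r _ =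
          f , f∈T , joins⇒incident j ,
          ws , subst (λ y → Walk G _ y _ ws) (joins⇒≡other j) (awayWalk walk (All¬⇒¬Any r∉ws)) , unique , a∈ws a∈
          where
          a∈ws : _ ∈ _ ∷ ws → _ ∈ ws
          a∈ws (here refl) = contradiction refl a≢r
          a∈ws (there a∈ws) = a∈ws

        comparable-below-r : Comparable G T r a b → a ≢ r → b ≢ r →
                             ∃[ f ] (f ∈ₛ T × Incident G f r ×
                                     Reach G (AwayFrom T) (other r f) a × Reach G (AwayFrom T) (other r f) b)
        comparable-below-r (inj₁ anc) a≢r b≢r with ancestor-below-r anc a≢r b≢r
        ... | f , f∈T , inc , ws , walk , _ , a∈ws = f , f∈T , inc , walk-prefix walk a∈ws , (ws , walk)
        comparable-below-r (inj₂ anc) a≢r b≢r with ancestor-below-r anc b≢r a≢r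
        ... | f , f∈T , inc , ws , walk , _ , b∈ws = f , f∈T , inc , (ws , walk) , walk-prefix walk b∈ws

        -- Two tree edges at r whose far ends are joined away from r would close a cycle through r.
        away-reach⇒≡ : f ∈ₛ T → Incident G f r → e ∈ₛ T → Incident G e r →
                       Reach G (AwayFrom T) (other r f) (other r e) → f ≡ e
        away-reach⇒≡ {f} {e} f∈T f-r e∈T e-r reach with f ≟ e
        ... | yes f≡e = f≡e
        ... | no f≢e = contradiction (reach-along (joins-other f-r) cycle) (acyclic f∈T)
          where
          cycle : Reach G (λ g → g ∈ₛ T × g ≢ f) r (other r f)
          cycle = reach-trans (reach-edge (e∈T , f≢e ∘ sym) (joins-other e-r))
                              (reach-sym (reach-map (λ (g∈T , ¬inc) → g∈T , λ { refl → ¬inc f-r }) reach))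

        missingEdge-reach : e ∈ edgesAt S r → e ∉ₛ T →
                            ∃[ f ] (f ∈ₛ T × Incident G f r × Reach G (AwayFrom T) (other r f) (other r e))
        missingEdge-reach e∈ e∉T with ∈-edgesAt⁻ e∈
        ... | e∈S , inc with normal e∈S e∉T
        ...   | ρ , ρ∈ , comparable with joins-ends {X = Reach G (InS G T) ρ} (joins-other inc)
                                                                     (proj₁ (comparable⇒reach comparable))
                                                                     (proj₂ (comparable⇒reach comparable))
        ...     | ρ→r , (_ , ρ→y) with ρ∈
        ...       | here refl = leave-r ρ→y (other-≢ inc)
        ...       | there ρ∈R′ = contradiction (reach-sym (reach-map within ρ→r)) (All.lookup r↛R′ ρ∈R′)

        treeEdges-apart : f ∈ₛ T → Incident G f r → g ∈ₛ T → Incident G g r → f ≢ g →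
                          ¬ ReachIn (S - r) (other r f) (other r g)
        treeEdges-apart {f} f∈T f-r g∈T g-r f≢g (_ , walk) = f≢g (away-reach⇒≡ f∈T f-r g∈T g-r (spread reach-refl walk))
          where
          -- Along a walk in S - r, a non-tree edge is normal: its ends hang below one tree edge at r,
          -- which must be f itself; so everything stays reachable from other r f away from r.
          step : Reach G (AwayFrom T) (other r f) a → EdgeOf (S - r) e → Joins G e a b →
                 Reach G (AwayFrom T) (other r f) b
          step {e = e} reach e∈S-r j with e ∈ₛ? T | edgeOf-─⁻ e∈S-r
          ... | yes e∈T | _ , ¬inc = reach-trans reach (reach-edge (e∈T , ¬inc) j)
          ... | no e∉T | e∈S , _ with normal e∈S e∉T
          ...   | ρ , here refl , comparable =
                    let (x∈ , y∈) = e∈S-r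
                        (f′ , f′∈T , f′-r , f′→x , f′→y) = comparable-below-r comparable (x∈p-y⇒x≢y x∈) (x∈p-y⇒x≢y y∈)
                        (f′→a , f′→b) = joins-ends j f′→x f′→y
                        f≡f′ = away-reach⇒≡ f∈T f-r f′∈T f′-r (reach-trans reach (reach-sym f′→a))
                    in subst (λ f → Reach G _ (other r f) _) (sym f≡f′) f′→b
          ...   | ρ , there ρ∈R′ , comparable =
                    let (ρ→x , ρ→y) = comparable⇒reach comparable
                        (ρ→a , _) = joins-ends j ρ→x ρ→y
                        r→a = reach-trans (reach-edge f∈T (joins-other f-r)) (reach-map proj₁ reach)
                    in contradiction (reach-map within (reach-trans r→a (reach-sym ρ→a))) (All.lookup r↛R′ ρ∈R′)

          spread : Reach G (AwayFrom T) (other r f) a → Walk G (EdgeOf (S - r)) a b vs →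
                   Reach G (AwayFrom T) (other r f) b
          spread reach nil = reach
          spread reach (cons e e∈S-r j walk) = spread (step reach e∈S-r j) walk

      roots : List (Fin E) → List (Fin V)
      roots C = map (other r) C ++ R′

      ∈-roots⁻ : ∀ {C} → ρ ∈ roots C → (∃[ f ] (f ∈ C × ρ ≡ other r f)) ⊎ ρ ∈ R′
      ∈-roots⁻ {C = C} ρ∈ = Data.Sum.map₁ (∈-map⁻ (other r)) (∈-++⁻ (map (other r) C) ρ∈)

      ∈-roots⁺ : ∀ {C} → f ∈ C → other r f ∈ roots C
      ∈-roots⁺ f∈C = ∈-++⁺ˡ (∈-map⁺ (other r) f∈C)

      FarEndsApart : List (Fin E) → Set
      FarEndsApart C = AllPairs (λ f g → ¬ ReachIn (S - r) (other r f) (other r g)) C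

      StarIs : Subset E → List (Fin E) → Set
      StarIs T C = (∀ {e} → e ∈ C → e ∈ₛ T) × (∀ {e} → e ∈ₛ T → Incident G e r → e ∈ C)

      module _ {C : List (Fin E)} (C⊆star : All (_∈ edgesAt S r) C) (apart : FarEndsApart C) where

        C-at-r : e ∈ C → EdgeOf S e × Incident G e r
        C-at-r = ∈-edgesAt⁻ ∘ All.lookup C⊆star

        apart⇒≡ : f ∈ C → g ∈ C → ReachIn (S - r) (other r f) (other r g) → f ≡ g
        apart⇒≡ {f} {g} f∈C g∈C reach with f ≟ g
        ... | yes f≡g = f≡g
        ... | no f≢g = contradiction reach (allPairs-∈ (λ ¬reach → ¬reach ∘ reach-sym) apart f∈C g∈C f≢g)

        module AddStar {F : Subset E} (good : GoodForest (S - r) (roots C) F) where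
          open GoodForest good

          F∪C : Subset E
          F∪C = F ∪ fromList C

          F⊆F∪C : e ∈ₛ F → e ∈ₛ F∪C
          F⊆F∪C = x∈p∪q⁺ ∘ inj₁

          C⊆F∪C : e ∈ C → e ∈ₛ F∪C
          C⊆F∪C = x∈p∪q⁺ ∘ inj₂ ∘ ∈-fromList⁺

          F-off-r : e ∈ₛ F → ¬ Incident G e r
          F-off-r = proj₂ ∘ edgeOf-─⁻ ∘ within

          at-r⇒C : e ∈ₛ F∪C → Incident G e r → e ∈ C
          at-r⇒C e∈F∪C inc with x∈p∪q⁻ F (fromList C) e∈F∪C
          ... | inj₁ e∈F = contradiction inc (F-off-r e∈F)
          ... | inj₂ e∈C = ∈-fromList⁻ e∈C

          off-r∖e : Walk G (λ g → g ∈ₛ F∪C × g ≢ e) u v vs → r ∉ vs → Walk G (λ g → g ∈ₛ F × g ≢ e) u v vs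
          off-r∖e = walk-restrict λ (g∈F∪C , g≢e) j a≢r b≢r → off-r g∈F∪C ([ a≢r , b≢r ]′ ∘ joins-incident j) , g≢e
            where
            off-r : e ∈ₛ F∪C → ¬ Incident G e r → e ∈ₛ F
            off-r e∈F∪C ¬inc with x∈p∪q⁻ F (fromList C) e∈F∪C
            ... | inj₁ e∈F = e∈F
            ... | inj₂ e∈C = contradiction (proj₂ (C-at-r (∈-fromList⁻ e∈C))) ¬inc

          liftPath : f ∈ C → Walk G (InS G F) (other r f) b vs → Unique vs →
                     Walk G (InS G F∪C) r b (r ∷ vs) × Unique (r ∷ vs)
          liftPath {vs = vs} f∈C walk unique =
            cons _ (C⊆F∪C f∈C) (joins-other inc) (walk-map F⊆F∪C walk) ,
            ¬Any⇒All¬ vs (walk-avoids F-off-r (other-≢ inc) walk) ∷ unique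
            where inc = proj₂ (C-at-r f∈C)

          liftComparable : f ∈ C → Comparable G F (other r f) a b → Comparable G F∪C r a b
          liftComparable f∈C = Data.Sum.map lift lift
            where
            lift : ∀ {a b} → Ancestor G F (other r _) a b → Ancestor G F∪C r a b
            lift (vs , walk , unique , a∈vs) = let (walkT , uniqueT) = liftPath f∈C walk unique
                                               in r ∷ vs , walkT , uniqueT , there a∈vs

          within′ : e ∈ₛ F∪C → EdgeOf S e
          within′ e∈F∪C with x∈p∪q⁻ F (fromList C) e∈F∪C
          ... | inj₁ e∈F = proj₁ (edgeOf-─⁻ (within e∈F))
          ... | inj₂ e∈C = proj₁ (C-at-r (∈-fromList⁻ e∈C))

          rooted′ : v ∈ₛ S → ∃[ ρ ] (ρ ∈ r ∷ R′ × Reach G (InS G F∪C) ρ v)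
          rooted′ {v} v∈S with v ≟ r
          ... | yes refl = r , here refl , reach-refl
          ... | no v≢r with rooted (x∈p∧x≢y⇒x∈p-y v∈S v≢r)
          ...   | ρ , ρ∈ , reach with ∈-roots⁻ ρ∈
          ...     | inj₁ (f , f∈C , refl) =
                      r , here refl , reach-trans (reach-edge (C⊆F∪C f∈C) (joins-other (proj₂ (C-at-r f∈C))))
                                                  (reach-map F⊆F∪C reach)
          ...     | inj₂ ρ∈R′ = ρ , there ρ∈R′ , reach-map F⊆F∪C reach

          acyclic-at-r : e ∈ C → ¬ Reach G (λ g → g ∈ₛ F∪C × g ≢ e) (proj₁ (ends e)) (proj₂ (ends e))
          acyclic-at-r {e} e∈C cycle =
            let inc = proj₂ (C-at-r e∈C)
                (_ , walk) = reach-across (joins-other inc) cycle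
                (f , y , (f∈F∪C , f≢e) , j , ws , walk′ , r∉ws) = walk-lastVisit walk (walk-head∈ walk) (other-≢ inc)
                y→e = reach-map (within ∘ proj₁) (ws , off-r∖e walk′ r∉ws)
            in f≢e (apart⇒≡ (at-r⇒C f∈F∪C (joins⇒incident j)) e∈C (subst (λ y → ReachIn _ y _) (joins⇒≡other j) y→e))

          -- A cycle through r would enter and leave r by edges of C whose far ends are joined in F.
          acyclic-off-r : e ∈ₛ F → ¬ Reach G (λ g → g ∈ₛ F∪C × g ≢ e) (proj₁ (ends e)) (proj₂ (ends e))
          acyclic-off-r {e} e∈F (vs , walk) with r ∈? vs
          ... | no r∉vs = acyclic e∈F (vs , off-r∖e walk r∉vs)
          ... | yes r∈vs =
            let (x∈ , y∈) = within e∈F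
                (f₁ , y₁ , (f₁∈F∪C , _) , j₁ , _ , walk₁ , r∉₁) = walk-firstVisit walk r∈vs (x∈p-y⇒x≢y x∈)
                (f₂ , y₂ , (f₂∈F∪C , _) , j₂ , _ , walk₂ , r∉₂) = walk-lastVisit walk r∈vs (x∈p-y⇒x≢y y∈)
                to-y₁ = (_ , off-r∖e walk₁ r∉₁)
                from-y₂ = (_ , off-r∖e walk₂ r∉₂)
                y₁→y₂ = reach-trans (reach-map (within ∘ proj₁) (reach-sym to-y₁))
                          (reach-trans (reach-edge (within e∈F) (inj₁ refl))
                                       (reach-map (within ∘ proj₁) (reach-sym from-y₂)))
                f₁≡f₂ = apart⇒≡ (at-r⇒C f₁∈F∪C (joins⇒incident j₁)) (at-r⇒C f₂∈F∪C (joins⇒incident j₂))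
                          (subst₂ (ReachIn _) (joins⇒≡other j₁) (joins⇒≡other j₂) y₁→y₂)
                y₁≡y₂ = trans (joins⇒≡other j₁) (trans (cong (other r) f₁≡f₂) (sym (joins⇒≡other j₂)))
            in acyclic e∈F (reach-trans to-y₁ (subst (λ y → Reach G _ y _) (sym y₁≡y₂) from-y₂))

          acyclic′ : e ∈ₛ F∪C → ¬ Reach G (λ g → g ∈ₛ F∪C × g ≢ e) (proj₁ (ends e)) (proj₂ (ends e))
          acyclic′ e∈F∪C with x∈p∪q⁻ F (fromList C) e∈F∪C
          ... | inj₁ e∈F = acyclic-off-r e∈F
          ... | inj₂ e∈C = acyclic-at-r (∈-fromList⁻ e∈C)

          normal-at-r : EdgeOf S e → Incident G e r → Comparable G F∪C r (proj₁ (ends e)) (proj₂ (ends e))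
          normal-at-r e∈S inc with rooted (x∈p∧x≢y⇒x∈p-y (proj₂ (edgeOf-joins e∈S (joins-other inc))) (other-≢ inc))
          ... | ρ , ρ∈ , reach with ∈-roots⁻ ρ∈
          ...   | inj₂ ρ∈R′ = contradiction (reach-trans (reach-edge e∈S (joins-other inc))
                                                        (reach-sym (reach-map (proj₁ ∘ edgeOf-─⁻ ∘ within) reach)))
                                            (All.lookup r↛R′ ρ∈R′)
          ...   | inj₁ (f , f∈C , refl) = let (vs , path , unique) = walk⇒path (proj₂ reach)
                                              (walkT , uniqueT) = liftPath f∈C path unique
                                          in ancestor-joins (joins-other inc) (r ∷ vs , walkT , uniqueT , here refl)

          normal′ : EdgeOf S e → e ∉ₛ F∪C → ∃[ ρ ] (ρ ∈ r ∷ R′ × Comparable G F∪C ρ (proj₁ (ends e)) (proj₂ (ends e)))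
          normal′ {e} e∈S e∉F∪C with incident? r e
          ... | yes inc = r , here refl , normal-at-r e∈S inc
          ... | no ¬inc with normal (edgeOf-─⁺ e∈S ¬inc) (e∉F∪C ∘ F⊆F∪C)
          ...   | ρ , ρ∈ , comparable with ∈-roots⁻ ρ∈
          ...     | inj₁ (f , f∈C , refl) = r , here refl , liftComparable f∈C comparable
          ...     | inj₂ ρ∈R′ = ρ , there ρ∈R′ , comparable-map F⊆F∪C comparable

          addStar-good : GoodForest S (r ∷ R′) F∪C
          addStar-good = record { within = within′ ; rooted = rooted′ ; acyclic = acyclic′ ; normal = normal′ }

          addStar-star : StarIs F∪C C
          addStar-star = C⊆F∪C , at-r⇒C

        module RemoveStar {T : Subset E} (good : GoodForest S (r ∷ R′) T) (star : StarIs T C) where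
          open GoodForest good
          open TreeAt good

          T─C : Subset E
          T─C = T ─ fromList C

          T─C⊆T : e ∈ₛ T─C → e ∈ₛ T
          T─C⊆T = p─q⊆p T (fromList C)

          away⇒T─C : AwayFrom T e → e ∈ₛ T─C
          away⇒T─C (e∈T , ¬inc) = x∈p∧x∉q⇒x∈p─q e∈T λ e∈C → ¬inc (proj₂ (C-at-r (∈-fromList⁻ e∈C)))

          T─C⇒away : e ∈ₛ T─C → AwayFrom T e
          T─C⇒away e∈ = T─C⊆T e∈ , λ inc → x∈p─q⇒x∉q T (fromList C) e∈ (∈-fromList⁺ (proj₂ star (T─C⊆T e∈) inc))

          within′ : e ∈ₛ T─C → EdgeOf (S - r) e
          within′ = away⇒S-r ∘ T─C⇒away

          rooted′ : v ∈ₛ S - r → ∃[ ρ ] (ρ ∈ roots C × Reach G (InS G T─C) ρ v)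
          rooted′ v∈S-r with rooted (p─q⊆p S ⁅ r ⁆ v∈S-r)
          ... | ρ , here refl , (_ , walk) =
                let (f , f∈T , inc , reach) = leave-r walk (x∈p-y⇒x≢y v∈S-r)
                in other r f , ∈-roots⁺ (proj₂ star f∈T inc) , reach-map (away⇒T─C) reach
          ... | ρ , there ρ∈R′ , (_ , walk) =
                ρ , ∈-++⁺ʳ _ ρ∈R′ , (_ , walk-map (away⇒T─C) (walkFromR′-away ρ∈R′ walk))

          acyclic′ : e ∈ₛ T─C → ¬ Reach G (λ g → g ∈ₛ T─C × g ≢ e) (proj₁ (ends e)) (proj₂ (ends e))
          acyclic′ e∈ cycle = acyclic (T─C⊆T e∈) (reach-map (λ (g∈ , g≢e) → T─C⊆T g∈ , g≢e) cycle)

          normal′ : EdgeOf (S - r) e → e ∉ₛ T─C →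
                    ∃[ ρ ] (ρ ∈ roots C × Comparable G T─C ρ (proj₁ (ends e)) (proj₂ (ends e)))
          normal′ {e} e∈S-r e∉ with edgeOf-─⁻ e∈S-r
          ... | e∈S , ¬inc with normal e∈S (λ e∈T → e∉ (away⇒T─C (e∈T , ¬inc)))
          ...   | ρ , there ρ∈R′ , comparable = ρ , ∈-++⁺ʳ _ ρ∈R′ , Data.Sum.map down down comparable
            where
            down : Ancestor G T ρ a b → Ancestor G T─C ρ a b
            down (vs , walk , unique , a∈) = vs , walk-map (away⇒T─C) (walkFromR′-away ρ∈R′ walk) , unique , a∈
          ...   | ρ , here refl , comparable = Data.Sum.[ below inj₁ x≢r y≢r , below inj₂ y≢r x≢r ]′ comparable
            where
            x≢r = x∈p-y⇒x≢y (proj₁ e∈S-r)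
            y≢r = x∈p-y⇒x≢y (proj₂ e∈S-r)
            below : (∀ {ρ} → Ancestor G T─C ρ a b → Comparable G T─C ρ (proj₁ (ends e)) (proj₂ (ends e))) →
                    a ≢ r → b ≢ r → Ancestor G T r a b →
                    ∃[ ρ ] (ρ ∈ roots C × Comparable G T─C ρ (proj₁ (ends e)) (proj₂ (ends e)))
            below orient a≢r b≢r anc with ancestor-below-r anc a≢r b≢r
            ... | f , f∈T , inc , ws , walk , unique , a∈ =
                  other r f , ∈-roots⁺ (proj₂ star f∈T inc) , orient (ws , walk-map (away⇒T─C) walk , unique , a∈)

          removeStar-good : GoodForest (S - r) (roots C) T─C
          removeStar-good = record { within = within′ ; rooted = rooted′ ; acyclic = acyclic′ ; normal = normal′ }

        -- F ↦ F ∪ C is the bijection; its inverse is T ↦ T ─ C.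
        extendByStar : ∀ {N} → HasExactly (GoodForest (S - r) (roots C)) N →
                       HasExactly (λ T → GoodForest S (r ∷ R′) T × StarIs T C) N
        extendByStar = hasExactly-map (λ F → F ∪ fromList C)
          (λ good → AddStar.addStar-good good , AddStar.addStar-star good)
          (λ (good , star) → _ , RemoveStar.removeStar-good good star , [p─q]∪q≡p (proj₁ star ∘ ∈-fromList⁻))
          (λ goodF goodF′ eq → trans (sym ([p∪q]─q≡p (disjoint goodF)))
                                     (trans (cong (_─ fromList C) eq) ([p∪q]─q≡p (disjoint goodF′))))
          where
          disjoint : ∀ {F} → GoodForest (S - r) (roots C) F → e ∈ₛ F → e ∉ₛ fromList C
          disjoint good e∈F e∈C = proj₂ (edgeOf-─⁻ (GoodForest.within good e∈F)) (proj₂ (C-at-r (∈-fromList⁻ e∈C)))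

    -- Counting good forests

    record Invariant (S : Subset V) (R : List (Fin V)) : Set where
      field
        roots∈S     : All (_∈ₛ S) R
        separated   : AllPairs (λ ρ ρ′ → ¬ ReachIn S ρ ρ′) R
        covered     : v ∈ₛ S → ∃[ ρ ] (ρ ∈ R × ReachIn S ρ v)
        subcubic    : v ∈ₛ S → degreeIn S v ≤ 3
        rootsDegree : All (λ ρ → degreeIn S ρ ≤ 2) R

    -- 2 ^ (edgeCount S + length R - ∣ S ∣) good forests, stated without the truncated subtraction.
    Counted : Subset V → List (Fin V) → Set
    Counted S R = ∃[ N ] (HasExactly (GoodForest S R) N × 2 ^ ∣ S ∣ * N ≡ 2 ^ (edgeCount S + length R))

    counted-noRoots : Invariant S [] → Counted S []
    counted-noRoots {S} inv =
      1 , hasExactly-singleton ∅-good ∅-unique , subst₂ (λ s x → 2 ^ s * 1 ≡ 2 ^ (x + 0)) (sym ∣S∣≡0) (sym edges≡0) refl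
      where
      S-empty : v ∉ₛ S
      S-empty v∈S with Invariant.covered inv v∈S
      ... | _ , () , _
      ∣S∣≡0 : ∣ S ∣ ≡ 0
      ∣S∣≡0 = trans (cong ∣_∣ (Empty-unique λ (_ , v∈S) → S-empty v∈S)) (∣⊥∣≡0 V)
      edges≡0 : edgeCount S ≡ 0
      edges≡0 = count-none (edgeOf? S) {allFin E} (All.tabulate λ _ e∈S → S-empty (proj₁ e∈S))
      ∅-good : GoodForest S [] ∅
      ∅-good = record { within = λ e∈∅ → contradiction e∈∅ ∉⊥ ; rooted = λ v∈S → contradiction v∈S S-empty
                      ; acyclic = λ e∈∅ → contradiction e∈∅ ∉⊥ ; normal = λ e∈S → contradiction (proj₁ e∈S) S-empty }
      ∅-unique : GoodForest S [] F → F ≡ ∅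
      ∅-unique good = Empty-unique λ (_ , e∈F) → S-empty (proj₁ (GoodForest.within good e∈F))

    module Peel {S : Subset V} {r : Fin V} {R′ : List (Fin V)} (inv : Invariant S (r ∷ R′)) where
      open Invariant inv

      r↛R′ : All (λ ρ → ¬ ReachIn S r ρ) R′
      r↛R′ = AllPairs.head separated

      open FirstRoot r↛R′

      r∈S : r ∈ₛ S
      r∈S = All.head roots∈S

      farEnd∈S-r : e ∈ edgesAt S r → other r e ∈ₛ S - r
      farEnd∈S-r e∈ = let (e∈S , inc) = ∈-edgesAt⁻ e∈
                      in x∈p∧x≢y⇒x∈p-y (proj₂ (edgeOf-joins e∈S (joins-other inc))) (other-≢ inc)

      invariant-step : ∀ {C} → All (_∈ edgesAt S r) C → FarEndsApart C →
                       (∀ {f} → f ∈ edgesAt S r → ∃[ e ] (e ∈ C × ReachIn (S - r) (other r e) (other r f))) →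
                       Invariant (S - r) (roots C)
      invariant-step {C} C⊆star apart cover = record
        { roots∈S = All.++⁺ (All.map⁺ (All.map farEnd∈S-r C⊆star))
                            (All.zipWith (λ (ρ∈S , r↛ρ) → x∈p∧x≢y⇒x∈p-y ρ∈S λ { refl → r↛ρ reach-refl })
                                         (All.tail roots∈S , r↛R′))
        ; separated = AllPairs.++⁺ (AllPairs.map⁺ apart) (AllPairs.map (_∘ reachIn-─) (AllPairs.tail separated))
                                   (All.map⁺ (All.map farEnd↛R′ C⊆star))
        ; covered = covered′
        ; subcubic = λ v∈ → ≤-trans (degreeIn-─ S r _) (subcubic (p─q⊆p S ⁅ r ⁆ v∈))
        ; rootsDegree = All.++⁺ (All.map⁺ (All.map farEnd-degree C⊆star))
                                (All.map (≤-trans (degreeIn-─ S r _)) (All.tail rootsDegree))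
        }
        where
        farEnd↛R′ : e ∈ edgesAt S r → All (λ ρ → ¬ ReachIn (S - r) (other r e) ρ) R′
        farEnd↛R′ e∈ = let (e∈S , inc) = ∈-edgesAt⁻ e∈
                       in All.map (λ r↛ρ reach → r↛ρ (reach-trans (reach-edge e∈S (joins-other inc)) (reachIn-─ reach)))
                                  r↛R′

        farEnd-degree : e ∈ edgesAt S r → degreeIn (S - r) (other r e) ≤ 2
        farEnd-degree e∈ = let (e∈S , inc) = ∈-edgesAt⁻ e∈
                           in s≤s⁻¹ (≤-trans (degreeIn-─-< e∈S inc) (subcubic (p─q⊆p S ⁅ r ⁆ (farEnd∈S-r e∈))))

        covered′ : v ∈ₛ S - r → ∃[ ρ ] (ρ ∈ roots C × ReachIn (S - r) ρ v)
        covered′ v∈ with covered (p─q⊆p S ⁅ r ⁆ v∈)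
        ... | ρ , here refl , reach =
              let (f , f∈ , f→v) = reachIn-firstEdge reach (x∈p-y⇒x≢y v∈ ∘ sym)
                  (e , e∈C , e→f) = cover f∈
              in other r e , ∈-roots⁺ e∈C , reach-trans e→f f→v
        ... | ρ , there ρ∈R′ , (vs , walk) with r ∈? vs
        ...   | yes r∈vs = contradiction (reach-sym (walk-prefix walk r∈vs)) (All.lookup r↛R′ ρ∈R′)
        ...   | no r∉vs = ρ , ∈-++⁺ʳ _ ρ∈R′ , (vs , walkIn-─ walk r∉vs)

      counted-step : ∀ {N} → HasExactly (GoodForest S (r ∷ R′)) N →
                     2 ^ ∣ S - r ∣ * N ≡ 2 ^ (edgeCount (S - r) + (degreeIn S r + length R′)) →
                     Counted S (r ∷ R′)
      counted-step {N} has formula = N , has , (begin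
        2 ^ ∣ S ∣ * N                       ≡⟨ cong (λ s → 2 ^ s * N) (∣p∣≡1+∣p-x∣ r∈S) ⟩
        2 * 2 ^ ∣ S - r ∣ * N                ≡⟨ *-assoc 2 (2 ^ ∣ S - r ∣) N ⟩
        2 * (2 ^ ∣ S - r ∣ * N)              ≡⟨ cong (2 *_) formula ⟩
        2 ^ suc (x + (d + ℓ))               ≡⟨ cong (λ k → 2 ^ suc k) (+-assoc x d ℓ) ⟨
        2 ^ suc (x + d + ℓ)                 ≡⟨ cong (2 ^_) (+-suc (x + d) ℓ) ⟨
        2 ^ (x + d + suc ℓ)                 ≡⟨ cong (λ k → 2 ^ (k + suc ℓ)) (edgeCount-─ S r) ⟩
        2 ^ (edgeCount S + suc (length R′)) ∎)
        where
        open ≡-Reasoning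
        x d ℓ : ℕ
        x = edgeCount (S - r)
        d = degreeIn S r
        ℓ = length R′

      treeEdge∈star : GoodForest S (r ∷ R′) T → e ∈ₛ T → Incident G e r → e ∈ edgesAt S r
      treeEdge∈star good e∈T inc = ∈-edgesAt⁺ (GoodForest.within good e∈T) inc

      -- A missing edge at r would have its far end below another tree edge at r, i.e. in the same component of S - r.
      wholeStar-forced : FarEndsApart (edgesAt S r) → GoodForest S (r ∷ R′) T → StarIs T (edgesAt S r)
      wholeStar-forced {T} apart good = inTree , treeEdge∈star good
        where
        inTree : e ∈ edgesAt S r → e ∈ₛ T
        inTree {e} e∈ with e ∈ₛ? T
        ... | yes e∈T = e∈T
        ... | no e∉T =
              let (f , f∈T , inc , f→e) = TreeAt.missingEdge-reach good e∈ e∉T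
                  f≡e = apart⇒≡ (All.tabulate id) apart (treeEdge∈star good f∈T inc) e∈
                                (reach-map (TreeAt.away⇒S-r good) f→e)
              in contradiction (subst (_∈ₛ T) f≡e f∈T) e∉T

      -- r lies on a cycle: a good forest uses exactly one of its two edges, and either choice works.
      module OnCycle {e f : Fin E} (eq : edgesAt S r ≡ e ∷ f ∷ [])
                     (e→f : ReachIn (S - r) (other r e) (other r f)) where

        e∈star : e ∈ edgesAt S r
        e∈star = subst (e ∈_) (sym eq) (here refl)

        f∈star : f ∈ edgesAt S r
        f∈star = subst (f ∈_) (sym eq) (there (here refl))

        e≢f : e ≢ f
        e≢f = All.head (AllPairs.head (subst Unique eq edgesAt-unique))

        cover : ∀ {c} → ReachIn (S - r) (other r c) (other r e) → ReachIn (S - r) (other r c) (other r f) →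
                g ∈ edgesAt S r → ∃[ c′ ] (c′ ∈ c ∷ [] × ReachIn (S - r) (other r c′) (other r g))
        cover c→e c→f g∈ with subst (_ ∈_) eq g∈
        ... | here refl = _ , here refl , c→e
        ... | there (here refl) = _ , here refl , c→f

        disjoint : GoodForest S (r ∷ R′) T × StarIs T (e ∷ []) → ¬ (GoodForest S (r ∷ R′) T × StarIs T (f ∷ []))
        disjoint (_ , star-e) (_ , star-f) with proj₂ star-e (proj₁ star-f (here refl)) (proj₂ (∈-edgesAt⁻ f∈star))
        ... | here f≡e = e≢f (sym f≡e)

        choose : GoodForest S (r ∷ R′) T →
                 (GoodForest S (r ∷ R′) T × StarIs T (e ∷ [])) ⊎ (GoodForest S (r ∷ R′) T × StarIs T (f ∷ []))
        choose {T} good with e ∈ₛ? T | f ∈ₛ? T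
        ... | yes e∈T | yes f∈T =
              contradiction e→f (TreeAt.treeEdges-apart good e∈T (proj₂ (∈-edgesAt⁻ e∈star))
                                                             f∈T (proj₂ (∈-edgesAt⁻ f∈star)) e≢f)
        ... | yes e∈T | no f∉T = inj₁ (good , (λ { (here refl) → e∈T }) , only-e)
          where
          only-e : g ∈ₛ T → Incident G g r → g ∈ e ∷ []
          only-e g∈T inc with subst (_ ∈_) eq (treeEdge∈star good g∈T inc)
          ... | here refl = here refl
          ... | there (here refl) = contradiction g∈T f∉T
        ... | no e∉T | yes f∈T = inj₂ (good , (λ { (here refl) → f∈T }) , only-f)
          where
          only-f : g ∈ₛ T → Incident G g r → g ∈ f ∷ []
          only-f g∈T inc with subst (_ ∈_) eq (treeEdge∈star good g∈T inc)
          ... | here refl = contradiction g∈T e∉T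
          ... | there (here refl) = here refl
        ... | no e∉T | no f∉T with TreeAt.missingEdge-reach good e∈star e∉T
        ...   | g , g∈T , inc , _ with subst (_ ∈_) eq (treeEdge∈star good g∈T inc)
        ...     | here refl = contradiction g∈T e∉T
        ...     | there (here refl) = contradiction g∈T f∉T

        counted-onCycle : (∀ {R} → Invariant (S - r) R → Counted (S - r) R) → Counted S (r ∷ R′)
        counted-onCycle count′ =
          let (N₁ , has₁ , formula₁) = count′ (invariant-step (e∈star ∷ []) ([] ∷ []) (cover reach-refl e→f))
              (N₂ , has₂ , formula₂) = count′ (invariant-step (f∈star ∷ []) ([] ∷ [])
                                                              (cover (reach-sym e→f) reach-refl))
          in counted-step (hasExactly-⇔ [ proj₁ , proj₁ ]′ choose
                            (hasExactly-⊎ disjoint (extendByStar (e∈star ∷ []) ([] ∷ []) has₁)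
                                                   (extendByStar (f∈star ∷ []) ([] ∷ []) has₂)))
                          (begin
                            2 ^ ∣ S - r ∣ * (N₁ + N₂)
                              ≡⟨ *-distribˡ-+ (2 ^ ∣ S - r ∣) N₁ N₂ ⟩
                            2 ^ ∣ S - r ∣ * N₁ + 2 ^ ∣ S - r ∣ * N₂
                              ≡⟨ cong₂ _+_ formula₁ (trans formula₂ (sym (+-identityʳ _))) ⟩
                            2 ^ suc (x + suc ℓ)
                              ≡⟨ cong (2 ^_) (+-suc x (suc ℓ)) ⟨
                            2 ^ (x + (2 + ℓ))
                              ≡⟨ cong (λ d → 2 ^ (x + (d + ℓ))) (cong length eq) ⟨
                            2 ^ (x + (degreeIn S r + ℓ)) ∎)
          where
          open ≡-Reasoning
          x ℓ : ℕ
          x = edgeCount (S - r)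
          ℓ = length R′

      module _ (count′ : ∀ {R} → Invariant (S - r) R → Counted (S - r) R) where

        counted-wholeStar : FarEndsApart (edgesAt S r) → Counted S (r ∷ R′)
        counted-wholeStar apart =
          let (N , has , formula) = count′ (invariant-step (All.tabulate id) apart λ f∈ → _ , f∈ , reach-refl)
          in counted-step (hasExactly-⇔ proj₁ (λ good → good , wholeStar-forced apart good)
                                        (extendByStar (All.tabulate id) apart has))
                          (trans formula (cong (λ k → 2 ^ (edgeCount (S - r) + k))
                                               (trans (length-++ (map (other r) (edgesAt S r)))
                                                      (cong (_+ length R′) (length-map (other r) (edgesAt S r))))))

        peel : Counted S (r ∷ R′)
        peel with edgesAt S r in eq
        ... | [] = counted-wholeStar (subst FarEndsApart (sym eq) [])
        ... | e ∷ [] = counted-wholeStar (subst FarEndsApart (sym eq) ([] ∷ []))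
        ... | e ∷ f ∷ [] with reachIn? (S - r) (other r e) (other r f)
        ...   | yes e→f = OnCycle.counted-onCycle eq e→f count′
        ...   | no e↛f = counted-wholeStar (subst FarEndsApart (sym eq) ((e↛f ∷ []) ∷ [] ∷ []))
        peel | _ ∷ _ ∷ _ ∷ _ = contradiction (subst (λ L → length L ≤ 2) eq (All.head rootsDegree)) λ { (s≤s (s≤s ())) }

    countGoodForests : ∀ {m} S R → ∣ S ∣ ≡ m → Invariant S R → Counted S R
    countGoodForests S [] _ inv = counted-noRoots inv
    countGoodForests {zero} S (r ∷ R′) |S|≡0 inv = contradiction (trans (sym (∣p∣≡1+∣p-x∣ (Peel.r∈S inv))) |S|≡0) λ ()
    countGoodForests {suc m} S (r ∷ R′) |S|≡1+m inv =
      Peel.peel inv (countGoodForests (S - r) _ (suc-injective (trans (sym (∣p∣≡1+∣p-x∣ (Peel.r∈S inv))) |S|≡1+m)))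

    -- Good trees

    handshake : sum (map (degree G) (allFin V)) ≡ 2 * E
    handshake = begin
      sum (map (degree G) (allFin V))
        ≡⟨ count-swap (λ v e → incident? v e) (allFin V) (allFin E) ⟩
      sum (map (λ e → count (λ v → incident? v e) (allFin V)) (allFin E))
        ≡⟨ sum-map-const _ 2 {allFin E} (All.tabulate λ _ → twoEnds) ⟩
      2 * length (allFin E)
        ≡⟨ cong (2 *_) (length-allFin E) ⟩
      2 * E ∎
      where
      open ≡-Reasoning
      twoEnds : count (λ v → incident? v e) (allFin V) ≡ 2
      twoEnds {e} = trans (sym (count-⊎ (proj₁ (ends e) ≟_) (proj₂ (ends e) ≟_) (λ v → incident? v e)
                                        (λ p q → loopless e (trans p (sym q))) id id (allFin V)))
                          (cong₂ _+_ (count-≟ (Unique.allFin⁺ V) (∈-allFin _))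
                                     (count-≟ (Unique.allFin⁺ V) (∈-allFin _)))

    module RootedAt {v0 : Fin V} {e0 : Fin E} (e0-v0 : Incident G e0 v0)
                    (deletionConnected : DeletionConnected G v0) where
      open FirstRoot {S = full} {r = v0} {R′ = []} []

      reachIn-deleted : u ≢ v0 → v ≢ v0 → ReachIn (full - v0) u v
      reachIn-deleted u≢v0 v≢v0 with deletionConnected _ _ u≢v0 v≢v0
      ... | vs , walk , avoids = vs , walkIn-─ (walk-map (λ _ → ∈⊤ , ∈⊤) walk) (All¬⇒¬Any (All.map (_∘ sym) avoids))

      goodTree⇒goodForest : GoodTree G v0 e0 T → GoodForest full (v0 ∷ []) T × StarIs T (e0 ∷ [])
      goodTree⇒goodForest {T} ((connected , acyclic) , e0∈T , normal) = good , (λ { (here refl) → e0∈T }) , only-e0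
        where
        good : GoodForest full (v0 ∷ []) T
        good = record { within = λ _ → ∈⊤ , ∈⊤ ; rooted = λ _ → v0 , here refl , connected v0 _
                      ; acyclic = acyclic _ ; normal = λ _ e∉T → v0 , here refl , normal _ e∉T }
        only-e0 : g ∈ₛ T → Incident G g v0 → g ∈ e0 ∷ []
        only-e0 {g} g∈T g-v0 with g ≟ e0
        ... | yes refl = here refl
        ... | no g≢e0 = contradiction (reachIn-deleted (other-≢ g-v0) (other-≢ e0-v0))
                                      (TreeAt.treeEdges-apart good g∈T g-v0 e0∈T e0-v0 g≢e0)

      goodForest⇒goodTree : GoodForest full (v0 ∷ []) T × StarIs T (e0 ∷ []) → GoodTree G v0 e0 T
      goodForest⇒goodTree {T} (good , star) =
        ((λ u v → reach-trans (reach-sym (fromRoot u)) (fromRoot v)) , λ _ → acyclic) , proj₁ star (here refl) ,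
        λ e e∉T → comparable (normal (∈⊤ , ∈⊤) e∉T)
        where
        open GoodForest good
        fromRoot : ∀ v → Reach G (InS G T) v0 v
        fromRoot v with rooted ∈⊤
        ... | _ , here refl , reach = reach
        comparable : ∃[ ρ ] (ρ ∈ v0 ∷ [] × Comparable G T ρ a b) → Comparable G T v0 a b
        comparable (_ , here refl , c) = c

      invariant : (∀ v → v ≢ v0 → degree G v ≡ 3) → Invariant (full - v0) (other v0 e0 ∷ [])
      invariant degree≡3 = record
        { roots∈S = x∈p∧x≢y⇒x∈p-y ∈⊤ (other-≢ e0-v0) ∷ []
        ; separated = [] ∷ []
        ; covered = λ v∈ → _ , here refl , reachIn-deleted (other-≢ e0-v0) (x∈p-y⇒x≢y v∈)
        ; subcubic = λ {v} v∈ → ≤-trans (degreeIn-─ full v0 v)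
                                         (≤-reflexive (trans (degreeIn-full v) (degree≡3 v (x∈p-y⇒x≢y v∈))))
        ; rootsDegree = s≤s⁻¹ (≤-trans (degreeIn-─-< (∈⊤ , ∈⊤) e0-v0)
                                       (≤-reflexive (trans (degreeIn-full _) (degree≡3 _ (other-≢ e0-v0))))) ∷ []
        }

      countGoodTrees : (∀ v → v ≢ v0 → degree G v ≡ 3) →
                       ∃[ N ] (HasExactly (GoodTree G v0 e0) N ×
                               2 ^ ∣ full - v0 ∣ * N ≡ 2 ^ (edgeCount (full - v0) + 1))
      countGoodTrees degree≡3 =
        let (N , goodForests , formula) = countGoodForests (full - v0) (other v0 e0 ∷ []) refl (invariant degree≡3)
        in N , hasExactly-⇔ goodForest⇒goodTree goodTree⇒goodForest
                 (extendByStar (∈-edgesAt⁺ (∈⊤ , ∈⊤) e0-v0 ∷ []) ([] ∷ []) goodForests) , formula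

      vertexCount : ∣ full - v0 ∣ + 1 ≡ V
      vertexCount = trans (+-comm ∣ full - v0 ∣ 1) (trans (sym (∣p∣≡1+∣p-x∣ (∈⊤ {x = v0}))) (∣⊤∣≡n V))

      edgeCount-deleted : edgeCount (full - v0) + degree G v0 ≡ E
      edgeCount-deleted = trans (cong (edgeCount (full - v0) +_) (sym (degreeIn-full v0)))
                                (trans (edgeCount-─ full v0) edgeCount-full)

      degreeSum : (∀ v → v ≢ v0 → degree G v ≡ 3) → 2 * E + 3 ≡ degree G v0 + 3 * V
      degreeSum degree≡3 = begin
        2 * E + 3
          ≡⟨ cong (_+ 3) handshake ⟨
        sum (map (degree G) (allFin V)) + 3
          ≡⟨ sum-map-except (degree G) 3 (Unique.allFin⁺ V) (∈-allFin v0) degree≡3 ⟩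
        degree G v0 + 3 * length (allFin V)
          ≡⟨ cong (λ l → degree G v0 + 3 * l) (length-allFin V) ⟩
        degree G v0 + 3 * V ∎
        where open ≡-Reasoning

-- With x edges and s vertices in G - v0, the exponent x + 1 - s is the cycle rank of G - v0.
cycleRank≡ : ∀ x k s n {E V} → x + k ≡ E → s + 1 ≡ V → 2 * E + 3 ≡ k + 3 * V → E + 3 ≡ 3 * n + 2 * k → x + 1 ≡ n + s
cycleRank≡ x k s n refl refl degreeSum size =
  *-cancelˡ-≡ (x + 1) (n + s) 3 (+-cancelʳ-≡ (3 * k + 3) (3 * (x + 1)) (3 * (n + s)) (begin
    3 * (x + 1) + (3 * k + 3)                ≡⟨ regroup₁ x k ⟩
    (x + k + 3) + (2 * (x + k) + 3)          ≡⟨ cong₂ _+_ size degreeSum ⟩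
    (3 * n + 2 * k) + (k + 3 * (s + 1))      ≡⟨ regroup₂ n k s ⟩
    3 * (n + s) + (3 * k + 3)                ∎))
  where
  open ≡-Reasoning
  regroup₁ : ∀ x k → 3 * (x + 1) + (3 * k + 3) ≡ (x + k + 3) + (2 * (x + k) + 3)
  regroup₁ = solve-∀
  regroup₂ : ∀ n k s → (3 * n + 2 * k) + (k + 3 * (s + 1)) ≡ 3 * (n + s) + (3 * k + 3)
  regroup₂ = solve-∀

2^-cancel : ∀ {s N n} → 2 ^ s * N ≡ 2 ^ (n + s) → N ≡ 2 ^ n
2^-cancel {s} {N} {n} eq = *-cancelˡ-≡ N (2 ^ n) (2 ^ s) {{m^n≢0 2 s}}
  (trans eq (trans (^-distribˡ-+-* 2 n s) (*-comm (2 ^ n) (2 ^ s))))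

mainTheorem14 : (G : Multigraph) (v0 : Fin (Multigraph.V G)) (e0 : Fin (Multigraph.E G)) (k n : ℕ) →
    Loopless G → Connected G → DeletionConnected G v0 →
    Incident G e0 v0 →
    degree G v0 ≡ k →
    ((v : Fin (Multigraph.V G)) → v ≢ v0 → degree G v ≡ 3) →
    Multigraph.E G + 3 ≡ 3 * n + 2 * k →
    HasExactly (GoodTree G v0 e0) (2 ^ n)
mainTheorem14 G v0 e0 k n loopless _ deletionConnected e0-v0 refl degree≡3 size
  with RootedAt.countGoodTrees G loopless e0-v0 deletionConnected degree≡3
... | N , goodTrees , formula =
  subst (HasExactly (GoodTree G v0 e0)) (2^-cancel {n = n} (trans formula (cong (2 ^_) cycleRank))) goodTrees
  where
  open RootedAt G loopless e0-v0 deletionConnected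
  cycleRank : edgeCount G (full - v0) + 1 ≡ n + ∣ full - v0 ∣
  cycleRank = cycleRank≡ _ _ _ n edgeCount-deleted vertexCount (degreeSum degree≡3) size
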